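{- Let $G=(V,E)$ be a graph, $k\ge 1$ an integer, $w:E\cup V\to\{1,2,\ldots,N\}$ a weight function and $\omega$ an integer. Let $\mathcal{R}_\omega$ be the set of pairs $(P,M)$ with $P\subseteq E$, $M\subseteq V$, $|M|=k$, such that the spanning subgraph $G[P]=(V,P)$ is a disjoint union of paths (isolated vertices allowed) and $\sum_{e\in P}w(e)+\sum_{v\in M}w(v)=\omega$. Let $\mathcal{S}_\omega$ be the set of $(P,M)\in\mathcal{R}_\omega$ such that every connected component of $G[P]$ contains a vertex of $M$. Let $\mathcal{C}_\omega$ be the set of tuples $((P,M),(V_1,V_2))$ with $(P,M)\in\mathcal{R}_\omega$, $(V_1,V_2)$ a partition of $V$ such that no edge of $P$ has one endpoint in $V_1$ and the other in $V_2$, and $M\subseteq V_1$. Then $|\mathcal{S}_\omega|\equiv|\mathcal{C}_\omega| \pmod 2$. -}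

module Defs where

open import Data.Nat using (ℕ; zero; suc; _+_)
open import Data.Bool using (Bool; true; false; _∧_; _∨_; not; if_then_else_)
open import Data.Fin using (Fin)
open import Data.Fin.Properties using (_≟_)
open import Data.Vec using (Vec; []; _∷_; lookup; tabulate)
open import Data.List using (List; []; _∷_; map; concatMap; allFin; foldr)
open import Data.Nat.ListAction using (sum)
open import Data.Integer using (ℤ; +_)
open import Data.Product using (_×_; _,_; proj₁; proj₂)
open import Data.Sum using (_⊎_)
open import Relation.Nullary using (¬_)
open import Relation.Nullary.Decidable using (⌊_⌋)
open import Relation.Binary.PropositionalEquality using (_≡_; _≢_)

record Graph : Set where
  field
    n        : ℕ
    m        : ℕ
    ends     : Fin m → Fin n × Fin n
    loopless : ∀ e → proj₁ (ends e) ≢ proj₂ (ends e)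
    simple   : ∀ e e' →
               (proj₁ (ends e) ≡ proj₁ (ends e') × proj₂ (ends e) ≡ proj₂ (ends e'))
               ⊎ (proj₁ (ends e) ≡ proj₂ (ends e') × proj₂ (ends e) ≡ proj₁ (ends e'))
               → e ≡ e'

SubsetB : ℕ → Set
SubsetB k = Vec Bool k

allSubsets : (k : ℕ) → List (SubsetB k)
allSubsets zero = [] ∷ []
allSubsets (suc k) = concatMap (λ s → (true ∷ s) ∷ (false ∷ s) ∷ []) (allSubsets k)

count : {A : Set} → (A → Bool) → List A → ℕ
count p = foldr (λ x c → if p x then suc c else c) 0

allF : (k : ℕ) → (Fin k → Bool) → Bool
allF k p = foldr (λ i b → p i ∧ b) true (allFin k)

anyF : (k : ℕ) → (Fin k → Bool) → Bool
anyF k p = foldr (λ i b → p i ∨ b) false (allFin k)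

size : {k : ℕ} → SubsetB k → ℕ
size {k} S = count (lookup S) (allFin k)

sumOver : {k : ℕ} → SubsetB k → (Fin k → ℕ) → ℕ
sumOver {k} S f = sum (map (λ i → if lookup S i then f i else 0) (allFin k))

module _ (G : Graph) where
  open Graph G

  fst snd : Fin m → Fin n
  fst e = proj₁ (ends e)
  snd e = proj₂ (ends e)

  incident : Fin m → Fin n → Bool
  incident e v = ⌊ fst e ≟ v ⌋ ∨ ⌊ snd e ≟ v ⌋

  degree : SubsetB m → Fin n → ℕ
  degree P v = count (λ e → lookup P e ∧ incident e v) (allFin m)

  step : SubsetB m → SubsetB n → SubsetB n
  step P R = tabulate λ v → lookup R v ∨
    anyF m (λ e → lookup P e ∧ incident e v ∧ (lookup R (fst e) ∨ lookup R (snd e)))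

  iter : ℕ → SubsetB m → SubsetB n → SubsetB n
  iter zero P R = R
  iter (suc i) P R = step P (iter i P R)

  singleton : Fin n → SubsetB n
  singleton u = tabulate λ v → ⌊ u ≟ v ⌋

  -- u and v lie in the same connected component of (V, P)
  -- (n closure steps suffice since any path has < n edges)
  connected : SubsetB m → Fin n → Fin n → Bool
  connected P u v = lookup (iter n P (singleton u)) v

  remove : SubsetB m → Fin m → SubsetB m
  remove P e = tabulate λ f → lookup P f ∧ not ⌊ e ≟ f ⌋

  -- (V, P) is acyclic (a forest): every edge of P is a bridge, i.e. its
  -- endpoints are disconnected in (V, P ∖ {e})
  acyclic : SubsetB m → Bool
  acyclic P = allF m λ e → not (lookup P e) ∨ not (connected (remove P e) (fst e) (snd e))

  -- (V, P) is a disjoint union of paths (isolated vertices allowed):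
  -- a forest with maximum degree at most 2
  linearForest : SubsetB m → Bool
  linearForest P = acyclic P ∧ allF n (λ v → ⌊ degree P v Data.Nat.≤? 2 ⌋)
    where import Data.Nat

  module _ (k : ℕ) (wE : Fin m → ℕ) (wV : Fin n → ℕ) (ω : ℤ) where

    weight : SubsetB m → SubsetB n → ℕ
    weight P M = sumOver P wE + sumOver M wV

    inR : SubsetB m × SubsetB n → Bool
    inR (P , M) = ⌊ size M Data.Nat.≟ k ⌋ ∧ linearForest P ∧ ⌊ (+ weight P M) Data.Integer.≟ ω ⌋
      where import Data.Nat
            import Data.Integer

    inS : SubsetB m × SubsetB n → Bool
    inS (P , M) = inR (P , M) ∧ allF n (λ v → anyF n (λ u → lookup M u ∧ connected P v u))

    -- ((P, M), (V₁, V₂)) ∈ C_ω, the partition encoded by V₁ (V₂ = V ∖ V₁)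
    inC : (SubsetB m × SubsetB n) × SubsetB n → Bool
    inC ((P , M) , V₁) = inR (P , M)
      ∧ allF m (λ e → not (lookup P e) ∨ ⌊ lookup V₁ (fst e) Data.Bool.≟ lookup V₁ (snd e) ⌋)
      ∧ allF n (λ v → not (lookup M v) ∨ lookup V₁ v)
      where import Data.Bool

    pairs : List (SubsetB m × SubsetB n)
    pairs = concatMap (λ P → map (λ M → (P , M)) (allSubsets n)) (allSubsets m)

    triples : List ((SubsetB m × SubsetB n) × SubsetB n)
    triples = concatMap (λ PM → map (λ V₁ → (PM , V₁)) (allSubsets n)) pairs

    cardS : ℕ
    cardS = count inS pairs

    cardC : ℕ
    cardC = count inC triples

{-# OPTIONS --safe #-}

-- Fix (P, M) ∈ R_ω.  The sets V₁ completing it to an element of C_ω are the unions of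
-- components of (V, P) that contain M.  If every component meets M, only V₁ = V qualifies.
-- Otherwise some component C avoids M, and V₁ ↦ V₁ △ C is a fixed-point-free involution on
-- the completions, so there are evenly many.  Thus the number of completions of (P, M) is
-- ≡ [(P, M) ∈ S_ω] (mod 2), and summing over all pairs gives the claim.
-- The components are those of Defs.connected, i.e. n closure steps from a vertex; this reaches
-- a fixed point, hence a set closed under P-edges, because the closure grows strictly until
-- it stabilises and never exceeds n elements.
module Submission where

open import Data.Nat using (ℕ; zero; suc; _+_; _%_; _<_; _≤_; z≤n; s≤s; NonZero)
open import Data.Nat.Properties using (+-suc; +-comm; +-identityʳ; *-comm; ≤-trans; ≤-<-trans; <⇒≱)
open import Data.Nat.DivMod using (%-distribˡ-+)
open import Data.Nat.Divisibility using (_∣_; divides; ∣m∣n⇒∣m+n; n∣m⇒m%n≡0)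
open import Data.Nat.GeneralisedArithmetic using (fold)
open import Data.Nat.ListAction using (sum)
open import Data.Bool using (Bool; true; false; T; not; _∧_; _∨_; _xor_; if_then_else_)
import Data.Bool as Bool
open import Data.Bool.Properties using (T?; T-∧; T-∨; T-≡; ⇔→≡; ¬-not; xor-identityʳ)
open import Data.Bool.ListAction using (all; any)
open import Data.Fin using (Fin)
open import Data.Fin.Properties using (_≟_)
open import Data.Fin.Subset using (Subset; _∈_; _⊆_; _⊄_; ∣_∣; ⊤)
open import Data.Fin.Subset.Properties using (_∈?_; _⊂?_; ⊆-antisym; ⊆⊤; ∣p∣≤n; ∣p∣≤∣x∷p∣; p⊂q⇒∣p∣<∣q∣)
open import Data.List using (List; []; _∷_; _++_; map; concatMap; allFin)
open import Data.List.Properties using (foldr-map; foldr-cong; map-cong)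
open import Data.List.Membership.Propositional.Properties using (∈-allFin)
import Data.List.Relation.Unary.All as All
open import Data.List.Relation.Unary.All.Properties using (all⁺; all⁻; ¬All⇒Any¬)
open import Data.List.Relation.Unary.Any using (satisfied)
open import Data.List.Relation.Unary.Any.Properties using (any⁺; any⁻)
open import Data.List.Membership.Propositional using (lose)
import Data.Vec as Vec
open import Data.Vec using (_∷_; lookup; zipWith; here; there)
open import Data.Vec.Properties using (lookup∘tabulate; lookup-zipWith; lookup-replicate; lookup⇒[]=; []=⇒lookup)
open import Data.Integer using (ℤ)
open import Data.Product using (∃; _×_; _,_; proj₁; proj₂)
open import Data.Sum using (_⊎_; inj₁; inj₂)
import Data.Sum as Sum
open import Function using (_∘_; Equivalence; mk⇔)
open import Relation.Nullary using (¬_; yes; no; contradiction)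
open import Relation.Nullary.Decidable using (⌊_⌋; toWitness; fromWitness; decidable-stable)
open import Relation.Binary.PropositionalEquality

open import Defs

open Equivalence

private variable
  A B : Set
  k : ℕ

T-injective : ∀ {a b} → (T a → T b) → (T b → T a) → a ≡ b
T-injective a⇒b b⇒a = ⇔→≡ {z = true} (mk⇔ (T-≡ .to ∘ a⇒b ∘ T-≡ .from) (T-≡ .to ∘ b⇒a ∘ T-≡ .from))

not∨-intro : ∀ a {b} → T b → T (not a ∨ b)
not∨-intro true  b = b
not∨-intro false _ = _

not∨-elim : ∀ {a b} → T (not a ∨ b) → T a → T b
not∨-elim {true} b _ = b

⌊xor≟xor⌋ : ∀ a b c → ⌊ a xor c Bool.≟ b xor c ⌋ ≡ ⌊ a Bool.≟ b ⌋
⌊xor≟xor⌋ true  true  true  = refl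
⌊xor≟xor⌋ true  true  false = refl
⌊xor≟xor⌋ true  false true  = refl
⌊xor≟xor⌋ true  false false = refl
⌊xor≟xor⌋ false true  true  = refl
⌊xor≟xor⌋ false true  false = refl
⌊xor≟xor⌋ false false true  = refl
⌊xor≟xor⌋ false false false = refl

count-++ : (p : A → Bool) (xs ys : List A) → count p (xs ++ ys) ≡ count p xs + count p ys
count-++ p []       ys = refl
count-++ p (x ∷ xs) ys with p x
... | true  = cong suc (count-++ p xs ys)
... | false = count-++ p xs ys

count-map : (p : B → Bool) (f : A → B) (xs : List A) → count p (map f xs) ≡ count (p ∘ f) xs
count-map p f []       = refl
count-map p f (x ∷ xs) = cong (λ c → if p (f x) then suc c else c) (count-map p f xs)

count-cong : {p q : A → Bool} → (∀ x → p x ≡ q x) → (xs : List A) → count p xs ≡ count q xs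
count-cong p≗q []       = refl
count-cong {q = q} p≗q (x ∷ xs) rewrite p≗q x =
  cong (λ c → if q x then suc c else c) (count-cong p≗q xs)

count-none : {p : A → Bool} → (∀ x → ¬ T (p x)) → (xs : List A) → count p xs ≡ 0
count-none         ¬p []       = refl
count-none {p = p} ¬p (x ∷ xs) with p x | ¬p x
... | true  | ¬px = contradiction _ ¬px
... | false | _   = count-none ¬p xs

count-concatMap : (p : B → Bool) (f : A → List B) (xs : List A) →
                  count p (concatMap f xs) ≡ sum (map (count p ∘ f) xs)
count-concatMap p f []       = refl
count-concatMap p f (x ∷ xs) =
  trans (count-++ p (f x) (concatMap f xs)) (cong (count p (f x) +_) (count-concatMap p f xs))

count-interleave : (p : B → Bool) (f g : A → B) (xs : List A) →
                   count p (concatMap (λ x → f x ∷ g x ∷ []) xs) ≡ count (p ∘ f) xs + count (p ∘ g) xs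
count-interleave p f g []       = refl
count-interleave p f g (x ∷ xs) with p (f x) | p (g x) | count-interleave p f g xs
... | true  | true  | ih = cong suc (trans (cong suc ih) (sym (+-suc _ _)))
... | true  | false | ih = cong suc ih
... | false | true  | ih = trans (cong suc ih) (sym (+-suc _ _))
... | false | false | ih = ih

count-concatMap-map : (p : A × B → Bool) (xs : List A) (ys : List B) →
                      count p (concatMap (λ x → map (x ,_) ys) xs) ≡
                      sum (map (λ x → count (λ y → p (x , y)) ys) xs)
count-concatMap-map p xs ys =
  trans (count-concatMap p (λ x → map (x ,_) ys) xs) (cong sum (map-cong (λ x → count-map p (x ,_) ys) xs))

count-as-sum : (p : A → Bool) (xs : List A) → count p xs ≡ sum (map (λ x → if p x then 1 else 0) xs)
count-as-sum p []       = refl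
count-as-sum p (x ∷ xs) with p x
... | true  = cong suc (count-as-sum p xs)
... | false = count-as-sum p xs

sum-map-%-cong : ∀ {m} .{{_ : NonZero m}} {f g : A → ℕ} → (∀ x → f x % m ≡ g x % m) →
                 (xs : List A) → sum (map f xs) % m ≡ sum (map g xs) % m
sum-map-%-cong                 f≡g []       = refl
sum-map-%-cong {m = m} {f} {g} f≡g (x ∷ xs) = begin
  (f x + sum (map f xs)) % m              ≡⟨ %-distribˡ-+ (f x) _ m ⟩
  (f x % m + sum (map f xs) % m) % m      ≡⟨ cong₂ (λ a b → (a + b) % m) (f≡g x) (sum-map-%-cong f≡g xs) ⟩
  (g x % m + sum (map g xs) % m) % m      ≡⟨ %-distribˡ-+ (g x) _ m ⟨
  (g x + sum (map g xs)) % m              ∎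
  where open ≡-Reasoning

allF≡all : (p : Fin k → Bool) → allF k p ≡ all p (allFin k)
allF≡all {k} p = sym (foldr-map _∧_ p true (allFin k))

anyF≡any : (p : Fin k → Bool) → anyF k p ≡ any p (allFin k)
anyF≡any {k} p = sym (foldr-map _∨_ p false (allFin k))

allF⁺ : {p : Fin k → Bool} → (∀ i → T (p i)) → T (allF k p)
allF⁺ {k} {p} h = subst T (sym (allF≡all p)) (all⁻ p (All.universal h (allFin k)))

allF⁻ : {p : Fin k → Bool} → T (allF k p) → ∀ i → T (p i)
allF⁻ {k} {p} h i = All.lookup (all⁺ p (allFin k) (subst T (allF≡all p) h)) (∈-allFin i)

¬allF⁻ : {p : Fin k → Bool} → ¬ T (allF k p) → ∃ λ i → ¬ T (p i)
¬allF⁻ {k} {p} h = satisfied (¬All⇒Any¬ (T? ∘ p) (allFin k) (h ∘ subst T (sym (allF≡all p)) ∘ all⁻ p))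

anyF⁺ : {p : Fin k → Bool} (i : Fin k) → T (p i) → T (anyF k p)
anyF⁺ {k} {p} i h = subst T (sym (anyF≡any p)) (any⁺ p (lose (∈-allFin i) h))

anyF⁻ : {p : Fin k → Bool} → T (anyF k p) → ∃ λ i → T (p i)
anyF⁻ {k} {p} h = satisfied (any⁻ p (allFin k) (subst T (anyF≡any p) h))

allF-cong : {p q : Fin k → Bool} → (∀ i → p i ≡ q i) → allF k p ≡ allF k q
allF-cong {k} p≗q = foldr-cong (λ i b → cong (_∧ b) (p≗q i)) refl (allFin k)

infixl 6 _△_

_△_ : Subset k → Subset k → Subset k
_△_ = zipWith _xor_

count-allSubsets-suc : (p : Subset (suc k) → Bool) →
  count p (allSubsets (suc k)) ≡ count (p ∘ (true ∷_)) (allSubsets k) + count (p ∘ (false ∷_)) (allSubsets k)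
count-allSubsets-suc {k} p = count-interleave p (true ∷_) (false ∷_) (allSubsets k)

count-allSubsets-△ : (q : Subset k → Bool) (d : Subset k) →
                     count (q ∘ (_△ d)) (allSubsets k) ≡ count q (allSubsets k)
count-allSubsets-△ q Vec.[] = refl
count-allSubsets-△ {suc k} q (true ∷ d) = begin
  count (q ∘ (_△ (true ∷ d))) (allSubsets (suc k))
    ≡⟨ count-allSubsets-suc (q ∘ (_△ (true ∷ d))) ⟩
  count (λ s → q (false ∷ s △ d)) (allSubsets k) + count (λ s → q (true ∷ s △ d)) (allSubsets k)
    ≡⟨ cong₂ _+_ (count-allSubsets-△ (q ∘ (false ∷_)) d) (count-allSubsets-△ (q ∘ (true ∷_)) d) ⟩
  count (q ∘ (false ∷_)) (allSubsets k) + count (q ∘ (true ∷_)) (allSubsets k)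
    ≡⟨ +-comm (count (q ∘ (false ∷_)) (allSubsets k)) (count (q ∘ (true ∷_)) (allSubsets k)) ⟩
  count (q ∘ (true ∷_)) (allSubsets k) + count (q ∘ (false ∷_)) (allSubsets k)
    ≡⟨ count-allSubsets-suc q ⟨
  count q (allSubsets (suc k)) ∎
  where open ≡-Reasoning
count-allSubsets-△ {suc k} q (false ∷ d) = begin
  count (q ∘ (_△ (false ∷ d))) (allSubsets (suc k))
    ≡⟨ count-allSubsets-suc (q ∘ (_△ (false ∷ d))) ⟩
  count (λ s → q (true ∷ s △ d)) (allSubsets k) + count (λ s → q (false ∷ s △ d)) (allSubsets k)
    ≡⟨ cong₂ _+_ (count-allSubsets-△ (q ∘ (true ∷_)) d) (count-allSubsets-△ (q ∘ (false ∷_)) d) ⟩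
  count (q ∘ (true ∷_)) (allSubsets k) + count (q ∘ (false ∷_)) (allSubsets k)
    ≡⟨ count-allSubsets-suc q ⟨
  count q (allSubsets (suc k)) ∎
  where open ≡-Reasoning

count-allSubsets-unique : {q : Subset k → Bool} (s₀ : Subset k) → T (q s₀) → (∀ s → T (q s) → s ≡ s₀) →
                          count q (allSubsets k) ≡ 1
count-allSubsets-unique {q = q} Vec.[] qs₀ _ with q Vec.[]
... | true = refl
count-allSubsets-unique {suc k} {q} (true ∷ s₀) qs₀ unique = begin
  count q (allSubsets (suc k))
    ≡⟨ count-allSubsets-suc q ⟩
  count (q ∘ (true ∷_)) (allSubsets k) + count (q ∘ (false ∷_)) (allSubsets k)
    ≡⟨ cong₂ _+_ (count-allSubsets-unique s₀ qs₀ (λ s → cong Vec.tail ∘ unique (true ∷ s)))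
                 (count-none (λ s → (λ ()) ∘ unique (false ∷ s)) (allSubsets k)) ⟩
  1 ∎
  where open ≡-Reasoning
count-allSubsets-unique {suc k} {q} (false ∷ s₀) qs₀ unique = begin
  count q (allSubsets (suc k))
    ≡⟨ count-allSubsets-suc q ⟩
  count (q ∘ (true ∷_)) (allSubsets k) + count (q ∘ (false ∷_)) (allSubsets k)
    ≡⟨ cong₂ _+_ (count-none (λ s → (λ ()) ∘ unique (true ∷ s)) (allSubsets k))
                 (count-allSubsets-unique s₀ qs₀ (λ s → cong Vec.tail ∘ unique (false ∷ s))) ⟩
  1 ∎
  where open ≡-Reasoning

2∣n+n : ∀ n → 2 ∣ n + n
2∣n+n n = divides n (trans (cong (n +_) (sym (+-identityʳ n))) (*-comm 2 n))

△-invariant⇒2∣count-allSubsets : {q : Subset k → Bool} {x : Fin k} {c : Subset k} → x ∈ c →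
                                  (∀ s → q (s △ c) ≡ q s) → 2 ∣ count q (allSubsets k)
△-invariant⇒2∣count-allSubsets {suc k} {q} {c = true ∷ c} _ invariant =
  subst (2 ∣_) (sym (trans (count-allSubsets-suc q) (cong (half +_) halves))) (2∣n+n half)
  where
  half : ℕ
  half = count (q ∘ (true ∷_)) (allSubsets k)
  halves : count (q ∘ (false ∷_)) (allSubsets k) ≡ half
  halves = trans (sym (count-allSubsets-△ (q ∘ (false ∷_)) c))
                 (count-cong (λ s → invariant (true ∷ s)) (allSubsets k))
△-invariant⇒2∣count-allSubsets {suc k} {q} {c = false ∷ c} (there x∈c) invariant =
  subst (2 ∣_) (sym (count-allSubsets-suc q))
    (∣m∣n⇒∣m+n (△-invariant⇒2∣count-allSubsets x∈c (invariant ∘ (true ∷_)))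
               (△-invariant⇒2∣count-allSubsets x∈c (invariant ∘ (false ∷_))))

Inflationary : (Subset k → Subset k) → Set
Inflationary f = ∀ {p} → p ⊆ f p

x∈p⇒0<∣p∣ : {x : Fin k} {p : Subset k} → x ∈ p → 0 < ∣ p ∣
x∈p⇒0<∣p∣                  here        = s≤s z≤n
x∈p⇒0<∣p∣ {p = side ∷ p} (there x∈p) = ≤-trans (x∈p⇒0<∣p∣ x∈p) (∣p∣≤∣x∷p∣ side p)

p⊆q∧p⊄q⇒p≡q : {p q : Subset k} → p ⊆ q → p ⊄ q → p ≡ q
p⊆q∧p⊄q⇒p≡q {p = p} p⊆q p⊄q =
  ⊆-antisym p⊆q λ {x} x∈q → decidable-stable (x ∈? p) (λ x∉p → p⊄q (p⊆q , x , x∈q , x∉p))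

⊆-fold : {f : Subset k → Subset k} → Inflationary f → ∀ {p} i → p ⊆ fold p f i
⊆-fold infl zero    = λ x∈p → x∈p
⊆-fold infl (suc i) = infl ∘ ⊆-fold infl i

fold-fixed-or-growing : {f : Subset k → Subset k} → Inflationary f → {x : Fin k} {p : Subset k} → x ∈ p →
                        ∀ i → f (fold p f i) ≡ fold p f i ⊎ i < ∣ fold p f i ∣
fold-fixed-or-growing infl x∈p zero = inj₂ (x∈p⇒0<∣p∣ x∈p)
fold-fixed-or-growing {f = f} infl {p = p} x∈p (suc i)
  with fold p f i ⊂? f (fold p f i) | fold-fixed-or-growing infl x∈p i
... | no  X⊄fX | _            = inj₁ (sym (cong f (p⊆q∧p⊄q⇒p≡q infl X⊄fX)))
... | yes _    | inj₁ fixed   = inj₁ (cong f fixed)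
... | yes X⊂fX | inj₂ growing = inj₂ (≤-<-trans growing (p⊂q⇒∣p∣<∣q∣ X⊂fX))

fold-fixed : {f : Subset k → Subset k} → Inflationary f → {x : Fin k} {p : Subset k} → x ∈ p →
             f (fold p f k) ≡ fold p f k
fold-fixed {k} {f} infl {p = p} x∈p with fold-fixed-or-growing infl x∈p k
... | inj₁ fixed = fixed
... | inj₂ k<∣X∣ = contradiction (∣p∣≤n (fold p f k)) (<⇒≱ k<∣X∣)

module _ (G : Graph) (P : Subset (Graph.m G)) where
  open Graph G using (n; m)

  Closed : Subset n → Set
  Closed C = ∀ e → T (lookup P e) → lookup C (fst G e) ≡ lookup C (snd G e)

  OnSide : Subset n → Bool → Subset n → Set
  OnSide V₁ b R = ∀ w → T (lookup R w) → lookup V₁ w ≡ b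

  component : Fin n → Subset n
  component v = iter G n P (singleton G v)

  reachedVia : Subset n → Fin n → Fin m → Bool
  reachedVia R w e = lookup P e ∧ incident G e w ∧ (lookup R (fst G e) ∨ lookup R (snd G e))

  lookup-step : ∀ R w → lookup (step G P R) w ≡ (lookup R w ∨ anyF m (reachedVia R w))
  lookup-step R w = lookup∘tabulate _ w

  incident-fst : ∀ e → T (incident G e (fst G e))
  incident-fst e = T-∨ {⌊ fst G e ≟ fst G e ⌋} {⌊ snd G e ≟ fst G e ⌋} .from (inj₁ (fromWitness refl))

  incident-snd : ∀ e → T (incident G e (snd G e))
  incident-snd e = T-∨ {⌊ fst G e ≟ snd G e ⌋} {⌊ snd G e ≟ snd G e ⌋} .from (inj₂ (fromWitness refl))

  incident⁻ : ∀ {e w} → T (incident G e w) → fst G e ≡ w ⊎ snd G e ≡ w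
  incident⁻ {e} {w} = Sum.map toWitness toWitness ∘ T-∨ {⌊ fst G e ≟ w ⌋} {⌊ snd G e ≟ w ⌋} .to

  step-inflationary : Inflationary (step G P)
  step-inflationary {R} {w} w∈R =
    lookup⇒[]= w _ (trans (lookup-step R w) (cong (_∨ anyF m (reachedVia R w)) ([]=⇒lookup w∈R)))

  step-absorbs : ∀ {R e w} → T (lookup P e) → T (incident G e w) →
                 T (lookup R (fst G e) ∨ lookup R (snd G e)) → T (lookup (step G P R) w)
  step-absorbs {R} {e} {w} pe ew reached =
    subst T (sym (lookup-step R w)) (T-∨ {lookup R w} .from (inj₂ (anyF⁺ {p = reachedVia R w} e
      (T-∧ {lookup P e} .from (pe , T-∧ {incident G e w} .from (ew , reached))))))

  fixed⇒Closed : ∀ {C} → step G P C ≡ C → Closed C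
  fixed⇒Closed {C} fixed e pe =
    T-injective (absorbed (incident-snd e) ∘ T-∨ {lookup C (fst G e)} .from ∘ inj₁)
                (absorbed (incident-fst e) ∘ T-∨ {lookup C (fst G e)} .from ∘ inj₂)
    where
    absorbed : ∀ {w} → T (incident G e w) → T (lookup C (fst G e) ∨ lookup C (snd G e)) → T (lookup C w)
    absorbed {w} ew reached = subst (λ X → T (lookup X w)) fixed (step-absorbs {R = C} pe ew reached)

  step-OnSide : ∀ {V₁ b R} → Closed V₁ → OnSide V₁ b R → OnSide V₁ b (step G P R)
  step-OnSide {V₁} {b} {R} closed onSide w h
    with T-∨ {lookup R w} .to (subst T (lookup-step R w) h)
  ... | inj₁ w∈R = onSide w w∈R
  ... | inj₂ viaEdge with anyF⁻ {p = reachedVia R w} viaEdge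
  ... | e , pe∧ew∧reached with T-∧ {lookup P e} .to pe∧ew∧reached
  ... | pe , ew∧reached with T-∧ {incident G e w} .to ew∧reached
  ... | ew , reached =
    trans (side-endpoint (incident⁻ ew)) (side-fst (T-∨ {lookup R (fst G e)} .to reached))
    where
    side-endpoint : fst G e ≡ w ⊎ snd G e ≡ w → lookup V₁ w ≡ lookup V₁ (fst G e)
    side-endpoint (inj₁ fst≡w) = cong (lookup V₁) (sym fst≡w)
    side-endpoint (inj₂ snd≡w) = trans (cong (lookup V₁) (sym snd≡w)) (sym (closed e pe))
    side-fst : T (lookup R (fst G e)) ⊎ T (lookup R (snd G e)) → lookup V₁ (fst G e) ≡ b
    side-fst (inj₁ fst∈R) = onSide _ fst∈R
    side-fst (inj₂ snd∈R) = trans (closed e pe) (onSide _ snd∈R)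

  iter-OnSide : ∀ {V₁ b R} → Closed V₁ → OnSide V₁ b R → ∀ i → OnSide V₁ b (iter G i P R)
  iter-OnSide closed onSide zero    = onSide
  iter-OnSide {V₁} {b} {R} closed onSide (suc i) =
    step-OnSide {V₁} {b} {iter G i P R} closed (iter-OnSide {V₁} {b} {R} closed onSide i)

  connected⇒same-side : ∀ {V₁ v w} → Closed V₁ → T (connected G P v w) → lookup V₁ w ≡ lookup V₁ v
  connected⇒same-side {V₁} {v} {w} closed =
    iter-OnSide {V₁} {lookup V₁ v} {singleton G v} closed singleton-OnSide n w
    where
    singleton-OnSide : OnSide V₁ (lookup V₁ v) (singleton G v)
    singleton-OnSide w h = cong (lookup V₁) (sym (toWitness (subst T (lookup∘tabulate _ w) h)))

  iter≡fold : ∀ R i → iter G i P R ≡ fold R (step G P) i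
  iter≡fold R zero    = refl
  iter≡fold R (suc i) = cong (step G P) (iter≡fold R i)

  v∈singleton : ∀ v → v ∈ singleton G v
  v∈singleton v = lookup⇒[]= v _ (trans (lookup∘tabulate _ v) (T-≡ .to (fromWitness refl)))

  v∈component : ∀ v → v ∈ component v
  v∈component v =
    subst (v ∈_) (sym (iter≡fold (singleton G v) n)) (⊆-fold step-inflationary n (v∈singleton v))

  component-Closed : ∀ v → Closed (component v)
  component-Closed v = fixed⇒Closed (subst (λ C → step G P C ≡ C) (sym (iter≡fold (singleton G v) n))
                                           (fold-fixed step-inflationary (v∈singleton v)))

module _ (G : Graph) (P : Subset (Graph.m G)) (M : Subset (Graph.n G)) where
  open Graph G using (n; m)

  edgeUncut : Subset n → Fin m → Bool
  edgeUncut V₁ e = not (lookup P e) ∨ ⌊ lookup V₁ (fst G e) Bool.≟ lookup V₁ (snd G e) ⌋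

  markedInside : Subset n → Fin n → Bool
  markedInside V₁ v = not (lookup M v) ∨ lookup V₁ v

  -- inC ((P , M) , V₁) unfolds to inR (P , M) ∧ compatible V₁, and inS (P , M) to inR (P , M) ∧ componentsMeetM.
  compatible : Subset n → Bool
  compatible V₁ = allF m (edgeUncut V₁) ∧ allF n (markedInside V₁)

  componentsMeetM : Bool
  componentsMeetM = allF n (λ v → anyF n (λ u → lookup M u ∧ connected G P v u))

  compatible⇒Closed : ∀ {V₁} → T (compatible V₁) → Closed G P V₁
  compatible⇒Closed {V₁} h e pe =
    toWitness (not∨-elim (allF⁻ (proj₁ (T-∧ {allF m (edgeUncut V₁)} .to h)) e) pe)

  compatible⇒M⊆ : ∀ {V₁} → T (compatible V₁) → ∀ v → T (lookup M v) → T (lookup V₁ v)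
  compatible⇒M⊆ {V₁} h v = not∨-elim (allF⁻ (proj₂ (T-∧ {allF m (edgeUncut V₁)} .to h)) v)

  compatible-⊤ : T (compatible ⊤)
  compatible-⊤ = T-∧ {allF m (edgeUncut ⊤)} .from (allF⁺ uncut , allF⁺ inside)
    where
    uncut : ∀ e → T (edgeUncut ⊤ e)
    uncut e = not∨-intro (lookup P e)
      (fromWitness (trans (lookup-replicate (fst G e) true) (sym (lookup-replicate (snd G e) true))))
    inside : ∀ v → T (markedInside ⊤ v)
    inside v = not∨-intro (lookup M v) (subst T (sym (lookup-replicate v true)) _)

  compatible-△ : ∀ {C} → Closed G P C → (∀ v → T (lookup M v) → lookup C v ≡ false) →
                 ∀ s → compatible (s △ C) ≡ compatible s
  compatible-△ {C} closed avoidsM s = cong₂ _∧_ (allF-cong uncut) (allF-cong inside)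
    where
    uncut : ∀ e → edgeUncut (s △ C) e ≡ edgeUncut s e
    uncut e with lookup P e in pe
    ... | false = refl
    ... | true  = begin
      ⌊ lookup (s △ C) (fst G e) Bool.≟ lookup (s △ C) (snd G e) ⌋
        ≡⟨ cong₂ (λ a b → ⌊ a Bool.≟ b ⌋) (lookup-zipWith _xor_ (fst G e) s C) (lookup-zipWith _xor_ (snd G e) s C) ⟩
      ⌊ lookup s (fst G e) xor lookup C (fst G e) Bool.≟ lookup s (snd G e) xor lookup C (snd G e) ⌋
        ≡⟨ cong (λ c → ⌊ lookup s (fst G e) xor lookup C (fst G e) Bool.≟ lookup s (snd G e) xor c ⌋)
                (sym (closed e (T-≡ .from pe))) ⟩
      ⌊ lookup s (fst G e) xor lookup C (fst G e) Bool.≟ lookup s (snd G e) xor lookup C (fst G e) ⌋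
        ≡⟨ ⌊xor≟xor⌋ (lookup s (fst G e)) (lookup s (snd G e)) (lookup C (fst G e)) ⟩
      ⌊ lookup s (fst G e) Bool.≟ lookup s (snd G e) ⌋ ∎
      where open ≡-Reasoning
    inside : ∀ v → markedInside (s △ C) v ≡ markedInside s v
    inside v with lookup M v in mv
    ... | false = refl
    ... | true  = trans (lookup-zipWith _xor_ v s C)
                        (trans (cong (lookup s v xor_) (avoidsM v (T-≡ .from mv))) (xor-identityʳ (lookup s v)))

  componentsMeetM⇒compatible⇒≡⊤ : T componentsMeetM → ∀ V₁ → T (compatible V₁) → V₁ ≡ ⊤
  componentsMeetM⇒compatible⇒≡⊤ meet V₁ h =
    ⊆-antisym ⊆⊤ (λ {v} _ → lookup⇒[]= v V₁ (T-≡ .to (inside v)))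
    where
    inside : ∀ v → T (lookup V₁ v)
    inside v with anyF⁻ (allF⁻ meet v)
    ... | u , mu∧vu with T-∧ {lookup M u} .to mu∧vu
    ... | mu , vu =
      subst T (connected⇒same-side G P {V₁} (compatible⇒Closed {V₁} h) vu) (compatible⇒M⊆ {V₁} h u mu)

  ¬componentsMeetM⇒2∣count : ¬ T componentsMeetM → 2 ∣ count compatible (allSubsets n)
  ¬componentsMeetM⇒2∣count ¬meet with ¬allF⁻ ¬meet
  ... | v , ¬meets = △-invariant⇒2∣count-allSubsets (v∈component G P v)
                       (compatible-△ (component-Closed G P v) avoidsM)
    where
    avoidsM : ∀ u → T (lookup M u) → lookup (component G P v) u ≡ false
    avoidsM u mu = ¬-not λ vu → ¬meets (anyF⁺ u (T-∧ {lookup M u} .from (mu , T-≡ .from vu)))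

  count-compatible-%2 : count compatible (allSubsets n) % 2 ≡ (if componentsMeetM then 1 else 0) % 2
  count-compatible-%2 with componentsMeetM in meet
  ... | true  = cong (_% 2) (count-allSubsets-unique ⊤ compatible-⊤
                               (componentsMeetM⇒compatible⇒≡⊤ (T-≡ .from meet)))
  ... | false = n∣m⇒m%n≡0 _ 2 (¬componentsMeetM⇒2∣count (subst T meet))

module _ (G : Graph) (k : ℕ) (wE : Fin (Graph.m G) → ℕ) (wV : Fin (Graph.n G) → ℕ) (ω : ℤ) where
  open Graph G using (n)

  inS-parity : ∀ PM → (if inS G k wE wV ω PM then 1 else 0) % 2 ≡
                      count (λ V₁ → inC G k wE wV ω (PM , V₁)) (allSubsets n) % 2
  inS-parity (P , M) with inR G k wE wV ω (P , M)
  ... | false = sym (cong (_% 2) (count-none (λ _ ()) (allSubsets n)))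
  ... | true  = sym (count-compatible-%2 G P M)

  cardS≡cardC[mod2] : cardS G k wE wV ω % 2 ≡ cardC G k wE wV ω % 2
  cardS≡cardC[mod2] = begin
    count (inS G k wE wV ω) (pairs G k wE wV ω) % 2
      ≡⟨ cong (_% 2) (count-as-sum (inS G k wE wV ω) (pairs G k wE wV ω)) ⟩
    sum (map (λ PM → if inS G k wE wV ω PM then 1 else 0) (pairs G k wE wV ω)) % 2
      ≡⟨ sum-map-%-cong inS-parity (pairs G k wE wV ω) ⟩
    sum (map (λ PM → count (λ V₁ → inC G k wE wV ω (PM , V₁)) (allSubsets n)) (pairs G k wE wV ω)) % 2
      ≡⟨ cong (_% 2) (count-concatMap-map (inC G k wE wV ω) (pairs G k wE wV ω) (allSubsets n)) ⟨
    count (inC G k wE wV ω) (triples G k wE wV ω) % 2 ∎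
    where open ≡-Reasoning

-- The congruence holds for each pair (P, M) separately.
lemma3 : (G : Graph) (k : ℕ) → 1 ≤ k → (N : ℕ)
         (wE : Fin (Graph.m G) → ℕ) (wV : Fin (Graph.n G) → ℕ) →
         (∀ e → 1 ≤ wE e × wE e ≤ N) → (∀ v → 1 ≤ wV v × wV v ≤ N) →
         (ω : ℤ) →
         cardS G k wE wV ω % 2 ≡ cardC G k wE wV ω % 2
lemma3 G k _ N wE wV _ _ ω = cardS≡cardC[mod2] G k wE wV ω
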